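{- Let $G=(L,R,E)$ be a finite bipartite graph whose vertex set $R$ is equipped with a linear ordering. Then for every matching $M$ in $G$ there exists a linear ordering $\succ$ of the vertices of $L$ such that the order of the greedy matching $M^\succ_G$ is less than or equal to the order of $M$ (in particular, if $M$ is $L$-saturating then so is $M^\succ_G$).
   Context: Let $y_1\succ y_2\succ\dots\succ y_N$ be the vertices of $R$ listed in order of preference. A matching $M$ is $L$-saturating if every vertex of $L$ is matched by $M$. The order of a matching $M$ is the smallest $k$ such that $M$ is $L$-saturating and leaves $y_{k+1},\dots,y_N$ unmatched; if $M$ is not $L$-saturating its order is $\infty$. Given a linear ordering $\succ$ of $L$, the greedy matching $M^\succ_G$ is the matching produced by the following procedure: start with $M=\emptyset$; while $M$ is not a maximal matching, let $L_M$ be the set of vertices of $L$ unmatched by $M$ that are adjacent to some vertex of $R$ unmatched by $M$, $R_M$ analogously, let $x^*$ be the most preferred vertex of $L_M$, let $y^*$ be the most preferred vertex of $R_M$ adjacent to $x^*$, and add the edge $\{x^*,y^*\}$ to $M$; return $M$ when it is maximal. -}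

module Defs where

open import Data.Nat using (ℕ; zero; suc; _≤_)
open import Data.Fin using (Fin; zero; suc; toℕ; _≟_)
open import Data.Fin.Permutation using (Permutation′; _⟨$⟩ʳ_)
open import Data.Bool using (Bool; true; false; _∧_; not; if_then_else_)
open import Data.Maybe using (Maybe; just; nothing; is-nothing)
open import Data.Empty using (⊥)
open import Data.Product using (Σ; _×_; ∃; _,_)
open import Relation.Binary.PropositionalEquality using (_≡_; _≢_)
open import Relation.Nullary.Decidable using (⌊_⌋)

-- A finite bipartite graph G = (L, R, E) with L = Fin m, R = Fin n.
-- The linear ordering on R is the order of Fin n: vertex index 0 is y₁
-- (most preferred), index 1 is y₂, etc.
record BipGraph : Set where
  field
    m : ℕ
    n : ℕ
    E : Fin m → Fin n → Bool

open BipGraph public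

EdgeSet : BipGraph → Set
EdgeSet G = Fin (m G) → Fin (n G) → Bool

record IsMatching (G : BipGraph) (M : EdgeSet G) : Set where
  field
    sub   : ∀ x y → M x y ≡ true → E G x y ≡ true
    uniqL : ∀ x y y′ → M x y ≡ true → M x y′ ≡ true → y ≡ y′
    uniqR : ∀ x x′ y → M x y ≡ true → M x′ y ≡ true → x ≡ x′

MatchedL : (G : BipGraph) → EdgeSet G → Fin (m G) → Set
MatchedL G M x = ∃ λ y → M x y ≡ true

MatchedR : (G : BipGraph) → EdgeSet G → Fin (n G) → Set
MatchedR G M y = ∃ λ x → M x y ≡ true

LSaturating : (G : BipGraph) → EdgeSet G → Set
LSaturating G M = ∀ x → MatchedL G M x

-- "order of M is ≤ k": M is L-saturating and leaves y_{k+1}, …, y_N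
-- (0-based indices ≥ k) unmatched.  The order of M is the least such k
-- (∞ if there is none), so  order M₁ ≤ order M₂  iff for every k,
-- OrderAtMost M₂ k implies OrderAtMost M₁ k.
OrderAtMost : (G : BipGraph) → EdgeSet G → ℕ → Set
OrderAtMost G M k =
  LSaturating G M × (∀ (y : Fin (n G)) → k ≤ toℕ y → MatchedR G M y → ⊥)

anyFin : ∀ {k} → (Fin k → Bool) → Bool
anyFin {zero}  p = false
anyFin {suc k} p = if p zero then true else anyFin (λ i → p (suc i))

firstFin : ∀ {k} → (Fin k → Bool) → Maybe (Fin k)
firstFin {zero}  p = nothing
firstFin {suc k} p with p zero
... | true  = just zero
... | false with firstFin (λ i → p (suc i))
...   | just i  = just (suc i)
...   | nothing = nothing

State : BipGraph → Set
State G = Fin (m G) → Maybe (Fin (n G))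

eqM : ∀ {k} → Maybe (Fin k) → Fin k → Bool
eqM nothing  y = false
eqM (just z) y = ⌊ z ≟ y ⌋

freeR : (G : BipGraph) → State G → Fin (n G) → Bool
freeR G f y = not (anyFin (λ x → eqM (f x) y))

inLM : (G : BipGraph) → State G → Fin (m G) → Bool
inLM G f x = is-nothing (f x) ∧ anyFin (λ y → E G x y ∧ freeR G f y)

update : ∀ {A : Set} {k} → (Fin k → A) → Fin k → A → Fin k → A
update f x a x′ = if ⌊ x ≟ x′ ⌋ then a else f x′

-- A linear ordering ≻ of L is given by a permutation σ : σ(0) ≻ σ(1) ≻ ⋯
-- (σ(i) is the (i+1)-th most preferred vertex of L).
greedyStep : (G : BipGraph) → Permutation′ (m G) → State G → State G
greedyStep G σ f with firstFin (λ i → inLM G f (σ ⟨$⟩ʳ i))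
... | nothing = f
... | just i with firstFin (λ y → E G (σ ⟨$⟩ʳ i) y ∧ freeR G f y)
...   | nothing = f
...   | just y  = update f (σ ⟨$⟩ʳ i) (just y)

iterate : ∀ {A : Set} → ℕ → (A → A) → A → A
iterate zero    g a = a
iterate (suc k) g a = g (iterate k g a)

-- Each non-trivial step matches a new vertex of L, so after |L| = m steps
-- the matching is maximal and the loop has terminated.
greedyState : (G : BipGraph) → Permutation′ (m G) → State G
greedyState G σ = iterate (m G) (greedyStep G σ) (λ _ → nothing)

greedyMatching : (G : BipGraph) → Permutation′ (m G) → EdgeSet G
greedyMatching G σ x y = eqM (greedyState G σ x) y

-- Order L by the rank of the M-partners, most preferred first.  Run greedily
-- in this order, step t matches the t-th vertex x of L to a vertex at least
-- as preferred as M(x): every earlier vertex x′ was matched no worse than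
-- M(x′), which is strictly preferred to M(x) because M is injective, so M(x)
-- is still free when x becomes the most preferred vertex of L_M.  Hence the
-- greedy matching is L-saturating and uses no vertex of R less preferred
-- than those used by M.
module Submission where

open import Defs
open import Data.Nat using (ℕ)
open import Data.Fin.Permutation using (Permutation′)
open import Data.Product using (Σ)

open import Data.Bool using (Bool; true; false; _∧_)
open import Data.Empty using (⊥)
open import Data.Fin using (Fin; zero; suc; toℕ; fromℕ<; punchIn; _≟_; _≤_; _<_)
open import Data.Fin.Permutation using (_⟨$⟩ʳ_; _⟨$⟩ˡ_; inverseʳ; insert; insert-punchIn)
import Data.Fin.Permutation as Perm
open import Data.Fin.Properties using (toℕ-injective; toℕ-fromℕ<; toℕ<n)
open import Data.Maybe using (Maybe; just; nothing; maybe′)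
open import Data.Nat as ℕ using (z≤n; s≤s; _≤?_)
open import Data.Nat.Properties as ℕ
  using (≤-refl; ≤-trans; ≤-<-trans; <⇒≤; <⇒≢; <⇒≱; ≰⇒>; ≤∧≢⇒<; <-≤-connex; m≤n⇒m<n∨m≡n)
open import Data.Product using (∃; _×_; _,_; proj₁; proj₂)
open import Data.Sum using (inj₁; inj₂)
open import Function using (_∘_)
open import Function.Bundles using (Injection)
open import Function.Properties.Inverse using (↔⇒↣)
open import Relation.Binary.PropositionalEquality
open import Relation.Nullary using (yes; no; contradiction)
open import Relation.Nullary.Decidable using (⌊_⌋; isYes≗does; dec-true; dec-false)

private
  variable
    k : ℕ

firstFin-just⇒least : (p : Fin k → Bool) {y : Fin k} → firstFin p ≡ just y →
  p y ≡ true × (∀ z → p z ≡ true → y ≤ z)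
firstFin-just⇒least {ℕ.suc k} p eq with p zero in p0
firstFin-just⇒least {ℕ.suc k} p refl | true = p0 , λ _ _ → z≤n
... | false with firstFin (p ∘ suc) in rest
firstFin-just⇒least {ℕ.suc k} p refl | false | just i = pi , least
  where
  pi : p (suc i) ≡ true
  pi = proj₁ (firstFin-just⇒least (p ∘ suc) rest)
  least : ∀ z → p z ≡ true → suc i ≤ z
  least zero    pz = contradiction (trans (sym p0) pz) λ ()
  least (suc z) pz = s≤s (proj₂ (firstFin-just⇒least (p ∘ suc) rest) z pz)

firstFin-nothing : (p : Fin k → Bool) → firstFin p ≡ nothing → ∀ z → p z ≡ false
firstFin-nothing {ℕ.suc k} p eq z with p zero in p0
firstFin-nothing {ℕ.suc k} p () z | true
... | false with firstFin (p ∘ suc) in rest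
firstFin-nothing {ℕ.suc k} p () z       | false | just _
firstFin-nothing {ℕ.suc k} p _  zero    | false | nothing = p0
firstFin-nothing {ℕ.suc k} p _  (suc z) | false | nothing = firstFin-nothing (p ∘ suc) rest z

firstFin-complete : (p : Fin k → Bool) (z : Fin k) → p z ≡ true → ∃ λ y → firstFin p ≡ just y
firstFin-complete p z pz with firstFin p in eq
... | just y  = y , refl
... | nothing = contradiction (trans (sym pz) (firstFin-nothing p eq z)) λ ()

least⇒firstFin-just : (p : Fin k → Bool) (y : Fin k) → p y ≡ true →
  (∀ z → z < y → p z ≡ false) → firstFin p ≡ just y
least⇒firstFin-just p zero    py _ rewrite py = refl
least⇒firstFin-just p (suc y) py earlier
  rewrite earlier zero (s≤s z≤n)
        | least⇒firstFin-just (p ∘ suc) y py (λ z z<y → earlier (suc z) (s≤s z<y)) = refl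

anyFin-true : (p : Fin k → Bool) (z : Fin k) → p z ≡ true → anyFin p ≡ true
anyFin-true {ℕ.suc k} p z pz with p zero in p0
... | true = refl
anyFin-true {ℕ.suc k} p zero    pz | false = contradiction (trans (sym p0) pz) λ ()
anyFin-true {ℕ.suc k} p (suc z) pz | false = anyFin-true (p ∘ suc) z pz

anyFin-false : (p : Fin k → Bool) → (∀ z → p z ≡ false) → anyFin p ≡ false
anyFin-false {ℕ.zero}  p none = refl
anyFin-false {ℕ.suc k} p none rewrite none zero = anyFin-false (p ∘ suc) (none ∘ suc)

⌊≟⌋-refl : (y : Fin k) → ⌊ y ≟ y ⌋ ≡ true
⌊≟⌋-refl y = trans (isYes≗does (y ≟ y)) (dec-true (y ≟ y) refl)

⌊≟⌋-≢ : {x y : Fin k} → x ≢ y → ⌊ x ≟ y ⌋ ≡ false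
⌊≟⌋-≢ {x = x} {y} x≢y = trans (isYes≗does (x ≟ y)) (dec-false (x ≟ y) x≢y)

eqM-true : {s : Maybe (Fin k)} {y : Fin k} → eqM s y ≡ true → s ≡ just y
eqM-true {s = just z} {y} eq with z ≟ y
... | yes refl = refl
eqM-true {s = just z} {y} () | no _

update-same : {A : Set} (g : Fin k → A) (x : Fin k) (a : A) → update g x a x ≡ a
update-same g x a rewrite ⌊≟⌋-refl x = refl

update-other : {A : Set} (g : Fin k → A) {x x′ : Fin k} (a : A) →
  x ≢ x′ → update g x a x′ ≡ g x′
update-other g a x≢x′ rewrite ⌊≟⌋-≢ x≢x′ = refl

Sorted : (Fin k → ℕ) → Permutation′ k → Set
Sorted h σ = ∀ {i j} → i < j → h (σ ⟨$⟩ʳ i) ℕ.≤ h (σ ⟨$⟩ʳ j)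

argmin : (h : Fin (ℕ.suc k) → ℕ) → ∃ λ x → ∀ z → h x ℕ.≤ h z
argmin {ℕ.zero}  h = zero , λ { zero → ≤-refl }
argmin {ℕ.suc k} h with argmin (h ∘ suc)
... | x , x-min with h zero ≤? h (suc x)
... | yes h0≤ = zero  , λ { zero → ≤-refl ; (suc z) → ≤-trans h0≤ (x-min z) }
... | no  h0≰ = suc x , λ { zero → <⇒≤ (≰⇒> h0≰) ; (suc z) → x-min z }

sortingPermutation : (h : Fin k → ℕ) → Σ (Permutation′ k) (Sorted h)
sortingPermutation {ℕ.zero}  h = Perm.id , λ {}
sortingPermutation {ℕ.suc k} h with argmin h
... | x , x-min with sortingPermutation (h ∘ punchIn x)
... | π , π-sorted = insert zero x π , sorted
  where
  sorted : Sorted h (insert zero x π)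
  sorted {zero}          _         = x-min _
  sorted {suc i} {suc j} (s≤s i<j)
    rewrite insert-punchIn zero x π i | insert-punchIn zero x π j = π-sorted i<j

⟨$⟩ʳ-injective : (σ : Permutation′ k) {i j : Fin k} → σ ⟨$⟩ʳ i ≡ σ ⟨$⟩ʳ j → i ≡ j
⟨$⟩ʳ-injective σ = Injection.injective (↔⇒↣ σ)

Sorted-injective-< : (h : Fin k → ℕ) (σ : Permutation′ k) → Sorted h σ →
  (∀ {x x′} → h x ≡ h x′ → x ≡ x′) → ∀ {i j} → i < j → h (σ ⟨$⟩ʳ i) ℕ.< h (σ ⟨$⟩ʳ j)
Sorted-injective-< h σ sorted h-injective i<j =
  ≤∧≢⇒< (sorted i<j) (<⇒≢ i<j ∘ cong toℕ ∘ ⟨$⟩ʳ-injective σ ∘ h-injective)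

∀-by-position : (σ : Permutation′ k) {P : Fin k → Set} → (∀ i → P (σ ⟨$⟩ʳ i)) → ∀ x → P x
∀-by-position σ {P} at-position x = subst P (inverseʳ σ) (at-position (σ ⟨$⟩ˡ x))

freeR-true : (G : BipGraph) (st : State G) (y : Fin (n G)) →
  (∀ x → eqM (st x) y ≡ false) → freeR G st y ≡ true
freeR-true G st y unmatched rewrite anyFin-false _ unmatched = refl

greedyStep-matches : (G : BipGraph) (σ : Permutation′ (m G)) (st : State G)
  (i : Fin (m G)) (y : Fin (n G)) →
  firstFin (λ j → inLM G st (σ ⟨$⟩ʳ j)) ≡ just i →
  firstFin (λ z → E G (σ ⟨$⟩ʳ i) z ∧ freeR G st z) ≡ just y →
  greedyStep G σ st ≡ update st (σ ⟨$⟩ʳ i) (just y)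
greedyStep-matches G σ st i y first-x first-y rewrite first-x | first-y = refl

MatchedNoWorse : (G : BipGraph) → State G → (Fin (m G) → Fin (n G)) → Fin (m G) → Set
MatchedNoWorse G st f x = ∃ λ y → st x ≡ just y × y ≤ f x

module GreedyAgainst (G : BipGraph) (σ : Permutation′ (m G)) (f : Fin (m G) → Fin (n G))
  (f-edge : ∀ x → E G x (f x) ≡ true)
  (f-injective : ∀ {x x′} → f x ≡ f x′ → x ≡ x′)
  (σ-sorted : Sorted (toℕ ∘ f) σ) where

  record Invariant (t : ℕ) (st : State G) : Set where
    field
      processed : ∀ i → toℕ i ℕ.< t → MatchedNoWorse G st f (σ ⟨$⟩ʳ i)
      pending   : ∀ i → t ℕ.≤ toℕ i → st (σ ⟨$⟩ʳ i) ≡ nothing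

  open Invariant

  earlier-preferred : ∀ {i j} → i < j → f (σ ⟨$⟩ʳ i) < f (σ ⟨$⟩ʳ j)
  earlier-preferred = Sorted-injective-< (toℕ ∘ f) σ σ-sorted (f-injective ∘ toℕ-injective)

  module Step (i : Fin (m G)) {st : State G} (inv : Invariant (toℕ i) st) where

    x : Fin (m G)
    x = σ ⟨$⟩ʳ i

    reference-free : freeR G st (f x) ≡ true
    reference-free = freeR-true G st (f x) (∀-by-position σ not-at)
      where
      not-at : ∀ j → eqM (st (σ ⟨$⟩ʳ j)) (f x) ≡ false
      not-at j with <-≤-connex (toℕ j) (toℕ i)
      ... | inj₂ i≤j rewrite pending inv j i≤j = refl
      ... | inj₁ j<i with processed inv j j<i
      ... | y , st≡ , y≤ rewrite st≡ =
        ⌊≟⌋-≢ (<⇒≢ (≤-<-trans y≤ (earlier-preferred j<i)) ∘ cong toℕ)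

    reference-available : (E G x (f x) ∧ freeR G st (f x)) ≡ true
    reference-available rewrite f-edge x | reference-free = refl

    x-first : firstFin (λ j → inLM G st (σ ⟨$⟩ʳ j)) ≡ just i
    x-first = least⇒firstFin-just _ i x-in-LM earlier-not-in-LM
      where
      x-in-LM : inLM G st x ≡ true
      x-in-LM rewrite pending inv i ≤-refl = anyFin-true _ (f x) reference-available
      earlier-not-in-LM : ∀ j → j < i → inLM G st (σ ⟨$⟩ʳ j) ≡ false
      earlier-not-in-LM j j<i with processed inv j j<i
      ... | _ , st≡ , _ rewrite st≡ = refl

    y-first : ∃ λ y → firstFin (λ z → E G x z ∧ freeR G st z) ≡ just y
    y-first = firstFin-complete _ (f x) reference-available

    y : Fin (n G)
    y = proj₁ y-first

    y≤ : y ≤ f x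
    y≤ = proj₂ (firstFin-just⇒least _ (proj₂ y-first)) (f x) reference-available

    step-matches : greedyStep G σ st ≡ update st x (just y)
    step-matches = greedyStep-matches G σ st i y x-first (proj₂ y-first)

    unchanged : ∀ {j} → toℕ j ≢ toℕ i → update st x (just y) (σ ⟨$⟩ʳ j) ≡ st (σ ⟨$⟩ʳ j)
    unchanged j≢i = update-other st (just y) (j≢i ∘ cong toℕ ∘ sym ∘ ⟨$⟩ʳ-injective σ)

    invariant : Invariant (ℕ.suc (toℕ i)) (greedyStep G σ st)
    invariant .processed j (s≤s j≤i) rewrite step-matches with m≤n⇒m<n∨m≡n j≤i
    ... | inj₁ j<i rewrite unchanged (<⇒≢ j<i) = processed inv j j<i
    ... | inj₂ j≡i rewrite toℕ-injective j≡i | update-same st x (just y) = y , refl , y≤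
    invariant .pending j i<j rewrite step-matches | unchanged (<⇒≢ i<j ∘ sym) =
      pending inv j (<⇒≤ i<j)

  invariant-after : ∀ t → t ℕ.≤ m G → Invariant t (iterate t (greedyStep G σ) (λ _ → nothing))
  invariant-after ℕ.zero    _   = record { processed = λ _ () ; pending = λ _ _ → refl }
  invariant-after (ℕ.suc t) t<m with fromℕ< t<m | toℕ-fromℕ< t<m
  ... | i | refl = Step.invariant i (invariant-after (toℕ i) (<⇒≤ t<m))

  greedy-no-worse : ∀ x → MatchedNoWorse G (greedyState G σ) f x
  greedy-no-worse = ∀-by-position σ λ i →
    processed (invariant-after (m G) ≤-refl) i (toℕ<n i)

greedyMatching-orderAtMost : (G : BipGraph) (σ : Permutation′ (m G))
  (f : Fin (m G) → Fin (n G)) {k : ℕ} →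
  (∀ x → MatchedNoWorse G (greedyState G σ) f x) → (∀ x → toℕ (f x) ℕ.< k) →
  OrderAtMost G (greedyMatching G σ) k
greedyMatching-orderAtMost G σ f {k} no-worse f<k = saturating , beyond-unmatched
  where
  saturating : LSaturating G (greedyMatching G σ)
  saturating x with no-worse x
  ... | y , st≡ , _ = y , subst (λ s → eqM s y ≡ true) (sym st≡) (⌊≟⌋-refl y)

  beyond-unmatched : ∀ y → k ℕ.≤ toℕ y → MatchedR G (greedyMatching G σ) y → ⊥
  beyond-unmatched y k≤y (x , matched) with no-worse x
  ... | y′ , st≡ , y′≤ with trans (sym st≡) (eqM-true matched)
  ... | refl = <⇒≱ (≤-<-trans y′≤ (f<k x)) k≤y

module Partner {G : BipGraph} {M : EdgeSet G}
  (M-matching : IsMatching G M) (saturating : LSaturating G M) where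

  partner-first : ∀ x → ∃ λ y → firstFin (M x) ≡ just y
  partner-first x = firstFin-complete (M x) (proj₁ (saturating x)) (proj₂ (saturating x))

  partner : Fin (m G) → Fin (n G)
  partner x = proj₁ (partner-first x)

  partner-∈ : ∀ x → M x (partner x) ≡ true
  partner-∈ x = proj₁ (firstFin-just⇒least (M x) (proj₂ (partner-first x)))

  partner-edge : ∀ x → E G x (partner x) ≡ true
  partner-edge x = IsMatching.sub M-matching x (partner x) (partner-∈ x)

  partner-injective : ∀ {x x′} → partner x ≡ partner x′ → x ≡ x′
  partner-injective {x} {x′} same = IsMatching.uniqR M-matching x x′ (partner x)
    (partner-∈ x) (subst (λ y → M x′ y ≡ true) (sym same) (partner-∈ x′))

theorem2 : (G : BipGraph) (M : EdgeSet G) → IsMatching G M →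
    Σ (Permutation′ (m G)) λ σ →
      (k : ℕ) → OrderAtMost G M k → OrderAtMost G (greedyMatching G σ) k
theorem2 G M M-matching = σ , greedy-order
  where
  -- The rank of an M-unmatched vertex is irrelevant: unless M is
  -- L-saturating there is nothing to prove.
  rank : Fin (m G) → ℕ
  rank x = maybe′ toℕ 0 (firstFin (M x))

  σ : Permutation′ (m G)
  σ = proj₁ (sortingPermutation rank)

  greedy-order : (k : ℕ) → OrderAtMost G M k → OrderAtMost G (greedyMatching G σ) k
  greedy-order k (saturating , beyond-unmatched) =
    greedyMatching-orderAtMost G σ partner
      (GreedyAgainst.greedy-no-worse G σ partner partner-edge partner-injective σ-sorted)
      (λ x → ≰⇒> λ k≤ → beyond-unmatched (partner x) k≤ (x , partner-∈ x))
    where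
    open Partner M-matching saturating

    σ-sorted : Sorted (toℕ ∘ partner) σ
    σ-sorted = subst₂ ℕ._≤_ (rank-partner _) (rank-partner _) ∘ proj₂ (sortingPermutation rank)
      where
      rank-partner : ∀ x → rank x ≡ toℕ (partner x)
      rank-partner x = cong (maybe′ toℕ 0) (proj₂ (partner-first x))
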